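{- For each integer $k\ge3$ let $\tau_k$ be the pattern $2\,1\,(k+1)\,k\,(k-1)\cdots 4\,3\in S_{k+1}$ (so $\tau_3=2143$, $\tau_4=21543$). Then $$\sum_{n\ge0}|S_n(123,3214,\tau_k)|\,x^n=\frac{1-2x+x^k}{1-3x+x^2+x^k}.$$ In particular, as $k\to\infty$ these generating functions converge coefficientwise to $\frac{1-2x}{1-3x+x^2}$, the generating function of the even-index Fibonacci numbers $1,1,2,5,13,34,\dots$.
   Context: $S_n$ is the set of permutations of $\{1,\dots,n\}$; $S_0$ contains only the empty permutation. A permutation $\pi$ contains a pattern $\gamma\in S_m$ if some subsequence of $\pi$ of length $m$ is order-isomorphic to $\gamma$; otherwise $\pi$ avoids $\gamma$. $S_n(\gamma_1,\dots,\gamma_r)$ is the set of permutations in $S_n$ avoiding every $\gamma_i$. -}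

module Defs where

open import Data.Nat using (ℕ; zero; suc; _+_; _∸_; _<_; _≟_)
open import Data.Integer as ℤ using (ℤ; +_; -_)
open import Data.List using (List; []; _∷_; map; upTo; length; foldr)
open import Data.List.Relation.Binary.Permutation.Propositional using (_↭_)
open import Data.List.Relation.Binary.Sublist.Propositional using (_⊆_)
open import Data.List.Relation.Unary.AllPairs using (AllPairs)
open import Data.List.Relation.Unary.All using (All)
open import Data.List.Relation.Unary.Unique.Propositional using (Unique)
open import Data.List.Membership.Propositional using (_∈_)
open import Data.List using (zip)
open import Data.Product using (Σ; _×_; _,_)
open import Function.Bundles using (_⇔_)
open import Relation.Binary.PropositionalEquality using (_≡_)
open import Relation.Nullary using (¬_; yes; no)

IsPerm : ℕ → List ℕ → Set
IsPerm n w = w ↭ map suc (upTo n)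

OrderIso : List ℕ → List ℕ → Set
OrderIso u v =
  (length u ≡ length v) ×
  AllPairs (λ p q → let (a , b) = p ; (c , d) = q in
                    ((a < c) ⇔ (b < d)) × ((c < a) ⇔ (d < b)))
           (zip u v)

Contains : List ℕ → List ℕ → Set
Contains π γ = Σ (List ℕ) λ s → (s ⊆ π) × OrderIso s γ

Avoids : List ℕ → List ℕ → Set
Avoids π γ = ¬ Contains π γ

InAv : ℕ → List (List ℕ) → List ℕ → Set
InAv n γs π = IsPerm n π × All (Avoids π) γs

HasCard : (List ℕ → Set) → ℕ → Set
HasCard P c = Σ (List (List ℕ)) λ L →
  Unique L × (∀ w → (w ∈ L) ⇔ P w) × (length L ≡ c)

p123 p3214 : List ℕ
p123 = 1 ∷ 2 ∷ 3 ∷ []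
p3214 = 3 ∷ 2 ∷ 1 ∷ 4 ∷ []

-- τ_k = 2 1 (k+1) k (k-1) … 4 3
tau : ℕ → List ℕ
tau k = 2 ∷ 1 ∷ map (λ i → k + 1 ∸ i) (upTo (k ∸ 1))

Series : Set
Series = ℕ → ℤ

_⊛_ : Series → Series → Series
(f ⊛ g) n = foldr ℤ._+_ (+ 0) (map (λ i → f i ℤ.* g (n ∸ i)) (upTo (suc n)))

δ : ℕ → ℕ → ℤ
δ n m with n ≟ m
... | yes _ = + 1
... | no _ = + 0

numer : ℕ → Series
numer k n = δ n 0 ℤ.- (+ 2) ℤ.* δ n 1 ℤ.+ δ n k

denom : ℕ → Series
denom k n = δ n 0 ℤ.- (+ 3) ℤ.* δ n 1 ℤ.+ δ n 2 ℤ.+ δ n k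

numer∞ denom∞ : Series
numer∞ n = δ n 0 ℤ.- (+ 2) ℤ.* δ n 1
denom∞ n = δ n 0 ℤ.- (+ 3) ℤ.* δ n 1 ℤ.+ δ n 2

avSet : ℕ → ℕ → List ℕ → Set
avSet k n = InAv n (p123 ∷ p3214 ∷ tau k ∷ [])

fib : ℕ → ℕ
fib 0 = 0
fib 1 = 1
fib (suc (suc n)) = fib (suc n) + fib n

-- even-index Fibonacci sequence 1,1,2,5,13,34,… (= F_{2n-1}, with 1 at n=0)
evenFib : ℕ → ℕ
evenFib 0 = 1
evenFib (suc n) = fib (suc (n + n))

{-# OPTIONS --safe #-}
module Submission where

-- In a permutation avoiding 123 and 3214 the largest entry n is among the first three:
-- otherwise the three entries before it, together with n, contain 123 or 3214. Deleting n
-- therefore organises the class into a generating tree. The entry n can always be put first,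
-- it can be put second after any nonempty member, and it can be put third after x y exactly
-- when y < x and fewer than k − 2 later entries exceed x (those entries decrease, so k − 2 of
-- them would complete a τ_k). Let a_n count the members of length n and e_n the nonempty
-- ones. The members x y r with y < x and fewer than b entries of r above x number
-- e_{n−1} + ⋯ + e_{n−b}, hence a_{n+1} − a_n = e_n + ⋯ + e_{n−k+2}, and differencing gives
-- a_{n+2} − 3a_{n+1} + a_n + e_{n−k+2} = 0, the coefficientwise form of the generating
-- function. While n ≤ k − 2 the last term vanishes, so up to length k the counts follow the
-- recurrence of the even-index Fibonacci numbers.

open import Defs
open import Data.Empty using (⊥; ⊥-elim)
open import Data.Integer as ℤ using (+_; -[1+_])
open import Data.Integer.Properties as ℤ using (pos-+; pos-*)
import Data.Integer.Tactic.RingSolver as ℤ-Solver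
open import Data.List using (List; []; _∷_; [_]; _++_; map; upTo; length; zip; filter; take; foldr)
open import Data.List.Properties
  using (length-map; length-++; length-upTo; length-take; map-applyUpTo; map-++; upTo-∷ʳ; ++-identityʳ;
         filter-all; filter-none; filter-accept; ∷-injectiveˡ; ∷-injectiveʳ)
open import Data.List.Membership.Propositional using (_∈_)
open import Data.List.Membership.Propositional.Properties
  using (∈-map⁺; ∈-map⁻; ∈-upTo⁺; ∈-upTo⁻; ∈-∃++; ∈-++⁺ˡ; ∈-++⁺ʳ; ∈-++⁻)
open import Data.List.Membership.Propositional.Properties.WithK using (unique∧set⇒bag)
open import Data.List.Relation.Binary.BagAndSetEquality using (∼bag⇒↭)
open import Data.List.Relation.Binary.Disjoint.Propositional using (Disjoint)
open import Data.List.Relation.Binary.Permutation.Propositional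
  using (_↭_; ↭-refl; ↭-prep; ↭-trans; ↭-sym; ↭-reflexive; ↭⇒↭ₛ)
open import Data.List.Relation.Binary.Permutation.Propositional.Properties
  using (∈-resp-↭; drop-mid; ∷↭∷ʳ; ↭-empty-inv; ↭-length) renaming (shift to ↭-shift)
import Data.List.Relation.Binary.Permutation.Setoid.Properties as PermutationSetoid
open import Data.List.Relation.Binary.Sublist.Propositional
  using (_⊆_; []; _∷_; _∷ʳ_; ⊆-refl; ⊆-trans; minimum; from∈)
open import Data.List.Relation.Binary.Sublist.Propositional.Properties
  using (All-resp-⊆; filter⁺; filter-⊆; take-⊆; length-mono-≤; ++⁺ˡ; ++⁺)
open import Data.List.Relation.Unary.All as All using (All; []; _∷_)
import Data.List.Relation.Unary.All.Properties as All
open import Data.List.Relation.Unary.AllPairs using (AllPairs; []; _∷_)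
import Data.List.Relation.Unary.AllPairs.Properties as AllPairs
open import Data.List.Relation.Unary.Any using (here)
open import Data.List.Relation.Unary.Unique.Propositional using (Unique)
import Data.List.Relation.Unary.Unique.Propositional.Properties as Unique
open import Data.Nat
  using (ℕ; zero; suc; _+_; _*_; _∸_; _<_; _>_; _≤_; _<?_; _≤?_; _≟_; z≤n; s≤s; z<s; s<s)
open import Data.Nat.Properties
open import Data.Nat.Tactic.RingSolver using (solve-∀)
open import Data.Product using (Σ; _×_; _,_; proj₁; proj₂)
open import Data.Sum using (_⊎_; inj₁; inj₂)
open import Function using (_∘_; const; id)
open import Function.Bundles using (_⇔_; mk⇔; Equivalence)
open import Relation.Binary.Definitions using (Tri; tri<; tri≈; tri>)
open import Relation.Binary.PropositionalEquality
  using (_≡_; _≢_; refl; sym; trans; cong; cong₂; subst; setoid; module ≡-Reasoning)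
open import Relation.Nullary using (¬_; yes; no)

open Equivalence using (to; from)

private variable
  a b c d e f i j n x y z N : ℕ
  p q r s v w π ρ : List ℕ
  xs ys zs : List (List ℕ)

-- Order isomorphism and the forbidden patterns

SameOrder : ℕ × ℕ → ℕ × ℕ → Set
SameOrder (a , b) (c , d) = ((a < c) ⇔ (b < d)) × ((c < a) ⇔ (d < b))

sameOrder-< : a < c → b < d → SameOrder (a , b) (c , d)
sameOrder-< a<c b<d =
  mk⇔ (const b<d) (const a<c) , mk⇔ (⊥-elim ∘ <-asym a<c) (⊥-elim ∘ <-asym b<d)

sameOrder-> : c < a → d < b → SameOrder (a , b) (c , d)
sameOrder-> c<a d<b =
  mk⇔ (⊥-elim ∘ <-asym c<a) (⊥-elim ∘ <-asym d<b) , mk⇔ (const d<b) (const c<a)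

sameOrder-<⁻ : SameOrder (a , b) (c , d) → b < d → a < c
sameOrder-<⁻ r = from (proj₁ r)

sameOrder->⁻ : SameOrder (a , b) (c , d) → d < b → c < a
sameOrder->⁻ r = from (proj₂ r)

module _ {P Q : ℕ → Set} {R : ℕ × ℕ → Set} where

  All-zip⁻ : (∀ {e f} → R (e , f) → Q f → P e) →
             length w ≡ length v → All R (zip w v) → All Q v → All P w
  All-zip⁻ {[]}    {[]}    R⇒ _  _        _        = []
  All-zip⁻ {_ ∷ w} {_ ∷ v} R⇒ eq (r ∷ rs) (q ∷ qs) = R⇒ r q ∷ All-zip⁻ R⇒ (suc-injective eq) rs qs

  All-zip⁺ : (∀ {e f} → P e → Q f → R (e , f)) → All P w → All Q v → All R (zip w v)
  All-zip⁺ PQ⇒ []       _        = []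
  All-zip⁺ PQ⇒ (_ ∷ _)  []       = []
  All-zip⁺ PQ⇒ (p ∷ ps) (q ∷ qs) = PQ⇒ p q ∷ All-zip⁺ PQ⇒ ps qs

AllPairs-zip⁻ : length w ≡ length v → AllPairs SameOrder (zip w v) → AllPairs _>_ v → AllPairs _>_ w
AllPairs-zip⁻ {[]}    {[]}    _  _        _        = []
AllPairs-zip⁻ {_ ∷ w} {_ ∷ v} eq (r ∷ rs) (q ∷ qs) =
  All-zip⁻ sameOrder->⁻ (suc-injective eq) r q ∷ AllPairs-zip⁻ (suc-injective eq) rs qs

AllPairs-zip⁺ : AllPairs _>_ w → AllPairs _>_ v → AllPairs SameOrder (zip w v)
AllPairs-zip⁺ []       _        = []
AllPairs-zip⁺ (_ ∷ _)  []       = []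
AllPairs-zip⁺ (p ∷ ps) (q ∷ qs) = All-zip⁺ sameOrder-> p q ∷ AllPairs-zip⁺ ps qs

-- tau (2 + K) is definitionally 2 ∷ 1 ∷ τ-descent K.
τ-descent : ℕ → List ℕ
τ-descent K = map (λ i → 2 + K + 1 ∸ i) (upTo (1 + K))

τ-descent-above-2 : ∀ K → All (2 <_) (τ-descent K)
τ-descent-above-2 K = All.map⁺ (All.applyUpTo⁺₁ id (1 + K) above)
  where
  above : i < 1 + K → 2 < 2 + K + 1 ∸ i
  above {i} (s≤s i≤K) = m+n≤o⇒m≤o∸n 3 (subst (3 + i ≤_) (+-comm 1 (2 + K)) (+-monoʳ-≤ 3 i≤K))

τ-descent-decreasing : ∀ K → AllPairs _>_ (τ-descent K)
τ-descent-decreasing K = AllPairs.map⁺ (AllPairs.applyUpTo⁺₁ id (1 + K)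
  (λ i<j j<1+K → ∸-monoʳ-< i<j (≤-trans (≤-pred j<1+K) (≤-trans (m≤n+m K 2) (m≤m+n (2 + K) 1)))))

length-τ-descent : ∀ K → length (τ-descent K) ≡ 1 + K
length-τ-descent K = trans (length-map _ (upTo (1 + K))) (length-upTo (1 + K))

-- The subsequences order-isomorphic to 123, 3214 and τ_{K+2}.
data Forbidden (K : ℕ) : List ℕ → Set where
  pat123  : a < b → b < c → Forbidden K (a ∷ b ∷ c ∷ [])
  pat3214 : c < b → b < a → a < d → Forbidden K (a ∷ b ∷ c ∷ d ∷ [])
  patτ    : b < a → All (a <_) (c ∷ s) → AllPairs _>_ (c ∷ s) → length s ≡ K →
            Forbidden K (a ∷ b ∷ c ∷ s)

module _ {K : ℕ} where

  orderIso-123⇒forbidden : OrderIso s p123 → Forbidden K s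
  orderIso-123⇒forbidden {[]}                (() , _)
  orderIso-123⇒forbidden {_ ∷ []}            (() , _)
  orderIso-123⇒forbidden {_ ∷ _ ∷ []}        (() , _)
  orderIso-123⇒forbidden {_ ∷ _ ∷ _ ∷ _ ∷ _} (() , _)
  orderIso-123⇒forbidden {_ ∷ _ ∷ _ ∷ []}    (_ , (ab ∷ _) ∷ (bc ∷ _) ∷ _) =
    pat123 (sameOrder-<⁻ ab (s<s z<s)) (sameOrder-<⁻ bc (s<s (s<s z<s)))

  orderIso-3214⇒forbidden : OrderIso s p3214 → Forbidden K s
  orderIso-3214⇒forbidden {[]}                    (() , _)
  orderIso-3214⇒forbidden {_ ∷ []}                (() , _)
  orderIso-3214⇒forbidden {_ ∷ _ ∷ []}            (() , _)
  orderIso-3214⇒forbidden {_ ∷ _ ∷ _ ∷ []}        (() , _)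
  orderIso-3214⇒forbidden {_ ∷ _ ∷ _ ∷ _ ∷ _ ∷ _} (() , _)
  orderIso-3214⇒forbidden {_ ∷ _ ∷ _ ∷ _ ∷ []}    (_ , (ab ∷ _ ∷ ad ∷ _) ∷ (bc ∷ _) ∷ _) =
    pat3214 (sameOrder->⁻ bc (s<s z<s)) (sameOrder->⁻ ab (s<s (s<s z<s)))
            (sameOrder-<⁻ ad (s<s (s<s (s<s z<s))))

  orderIso-τ⇒forbidden : OrderIso s (tau (2 + K)) → Forbidden K s
  orderIso-τ⇒forbidden {[]}            (() , _)
  orderIso-τ⇒forbidden {_ ∷ []}        (() , _)
  orderIso-τ⇒forbidden {_ ∷ _ ∷ []}    (() , _)
  orderIso-τ⇒forbidden {_ ∷ _ ∷ _ ∷ s} (eq , (ab ∷ a-cs) ∷ (_ ∷ cs-cs)) =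
    patτ (sameOrder->⁻ ab (s<s z<s)) (All-zip⁻ sameOrder-<⁻ len a-cs (τ-descent-above-2 K))
         (AllPairs-zip⁻ len cs-cs (τ-descent-decreasing K)) (suc-injective (trans len (length-τ-descent K)))
    where
    len : suc (length s) ≡ length (τ-descent K)
    len = suc-injective (suc-injective eq)

  forbidden⇒orderIso : Forbidden K s → OrderIso s p123 ⊎ OrderIso s p3214 ⊎ OrderIso s (tau (2 + K))
  forbidden⇒orderIso (pat123 a<b b<c) = inj₁ (refl ,
    (sameOrder-< a<b (s<s z<s) ∷ sameOrder-< (<-trans a<b b<c) (s<s z<s) ∷ []) ∷
    (sameOrder-< b<c (s<s (s<s z<s)) ∷ []) ∷ [] ∷ [])
  forbidden⇒orderIso (pat3214 c<b b<a a<d) = inj₂ (inj₁ (refl ,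
    (sameOrder-> b<a (s<s (s<s z<s)) ∷ sameOrder-> (<-trans c<b b<a) (s<s z<s) ∷
     sameOrder-< a<d (s<s (s<s (s<s z<s))) ∷ []) ∷
    (sameOrder-> c<b (s<s z<s) ∷ sameOrder-< (<-trans b<a a<d) (s<s (s<s z<s)) ∷ []) ∷
    (sameOrder-< (<-trans c<b (<-trans b<a a<d)) (s<s z<s) ∷ []) ∷ [] ∷ []))
  forbidden⇒orderIso (patτ b<a a<cs cs-decreasing len) = inj₂ (inj₂ (
    cong (suc ∘ suc) (trans (cong suc len) (sym (length-τ-descent K))) ,
    (sameOrder-> b<a (s<s z<s) ∷ All-zip⁺ sameOrder-< a<cs (τ-descent-above-2 K)) ∷
    (All-zip⁺ sameOrder-< (All.map (<-trans b<a) a<cs) (All.map (<-trans (s<s z<s)) (τ-descent-above-2 K)) ∷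
     AllPairs-zip⁺ cs-decreasing (τ-descent-decreasing K))))

Avoiding : ℕ → List ℕ → Set
Avoiding K π = ∀ {s} → s ⊆ π → ¬ Forbidden K s

avoids-patterns⇔ : ∀ {K} → All (Avoids π) (p123 ∷ p3214 ∷ tau (2 + K) ∷ []) ⇔ Avoiding K π
avoids-patterns⇔ {π} {K} = mk⇔ avoiding avoids
  where
  avoiding : All (Avoids π) (p123 ∷ p3214 ∷ tau (2 + K) ∷ []) → Avoiding K π
  avoiding (no123 ∷ no3214 ∷ noτ ∷ []) {s} sub bad with forbidden⇒orderIso bad
  ... | inj₁ iso        = no123 (s , sub , iso)
  ... | inj₂ (inj₁ iso) = no3214 (s , sub , iso)
  ... | inj₂ (inj₂ iso) = noτ (s , sub , iso)

  avoids : Avoiding K π → All (Avoids π) (p123 ∷ p3214 ∷ tau (2 + K) ∷ [])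
  avoids av = (λ (_ , sub , iso) → av sub (orderIso-123⇒forbidden iso))
            ∷ (λ (_ , sub , iso) → av sub (orderIso-3214⇒forbidden iso))
            ∷ (λ (_ , sub , iso) → av sub (orderIso-τ⇒forbidden iso)) ∷ []

-- Where the maximum can go

countAbove : ℕ → List ℕ → ℕ
countAbove x r = length (filter (x <?_) r)

countAbove-⊆ : s ⊆ r → All (x <_) s → length s ≤ countAbove x r
countAbove-⊆ {s} {r} {x} sub x<s = subst (_≤ countAbove x r) (cong length (filter-all (x <?_) x<s))
  (length-mono-≤ (filter⁺ (x <?_) (x <?_) (λ { refl x<e → x<e }) sub))

countAbove-insert : x < N → countAbove x (N ∷ r) ≡ suc (countAbove x r)
countAbove-insert {x} x<N = cong length (filter-accept (x <?_) x<N)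

countAbove-max : All (_< N) r → countAbove N r ≡ 0
countAbove-max {N} r<N = cong length (filter-none (N <?_) (All.map <-asym r<N))

-- x y r admits a new maximum N in third position exactly when x y N r creates
-- neither a 123 (via x < y) nor a τ (via K entries of r above x).
Open : ℕ → List ℕ → Set
Open b (x ∷ y ∷ r) = y < x × countAbove x r < b
Open b _           = ⊥

Open-mono : ∀ {b b′} → b ≤ b′ → Open b π → Open b′ π
Open-mono {x ∷ y ∷ r} b≤b′ (y<x , few) = y<x , <-≤-trans few b≤b′

Open-zero : ¬ Open 0 π
Open-zero {x ∷ y ∷ r} (_ , ())

Open-third⇔ : ∀ {b} → x < N → Open (suc b) (x ∷ y ∷ N ∷ r) ⇔ Open b (x ∷ y ∷ r)
Open-third⇔ {x} {N} {y} {r} x<N = mk⇔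
  (λ (y<x , few) → y<x , ≤-pred (subst (_< _) (countAbove-insert x<N) few))
  (λ (y<x , few) → y<x , subst (_< _) (sym (countAbove-insert {r = r} x<N)) (s<s few))

module _ {K : ℕ} where

  avoiding-⊆ : π ⊆ ρ → Avoiding K ρ → Avoiding K π
  avoiding-⊆ π⊆ρ av sub = av (⊆-trans sub π⊆ρ)

  forbidden-max-first : All (_< N) s → ¬ Forbidden K (N ∷ s)
  forbidden-max-first (b<N ∷ _)          (pat123 N<b _)         = <-asym N<b b<N
  forbidden-max-first (_ ∷ _ ∷ d<N ∷ []) (pat3214 _ _ N<d)      = <-asym N<d d<N
  forbidden-max-first (_ ∷ c<N ∷ _)      (patτ _ (N<c ∷ _) _ _) = <-asym N<c c<N

  forbidden-max-second : x < N → All (_< N) s → ¬ Forbidden K (x ∷ N ∷ s)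
  forbidden-max-second x<N (c<N ∷ _) (pat123 _ N<c)    = <-asym N<c c<N
  forbidden-max-second x<N _         (pat3214 _ N<x _) = <-asym N<x x<N
  forbidden-max-second x<N _         (patτ N<x _ _ _)  = <-asym N<x x<N

  forbidden-max-third : y < N → Open K (x ∷ y ∷ r) → s ⊆ r → ¬ Forbidden K (x ∷ y ∷ N ∷ s)
  forbidden-max-third y<N (y<x , _)   sub (pat123 x<y _)            = <-asym x<y y<x
  forbidden-max-third y<N _           sub (pat3214 N<y _ _)         = <-asym N<y y<N
  forbidden-max-third y<N (_ , few)   sub (patτ _ (_ ∷ x<s) _ refl) = <⇒≱ few (countAbove-⊆ sub x<s)

  avoiding-max-first : All (_< N) π → Avoiding K π → Avoiding K (N ∷ π)
  avoiding-max-first π<N av (_ ∷ʳ sub)   = av sub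
  avoiding-max-first π<N av (refl ∷ sub) = forbidden-max-first (All-resp-⊆ sub π<N)

  avoiding-max-second : x < N → All (_< N) r → Avoiding K (x ∷ r) → Avoiding K (x ∷ N ∷ r)
  avoiding-max-second x<N r<N av (_ ∷ʳ sub)          =
    avoiding-max-first r<N (avoiding-⊆ (_ ∷ʳ ⊆-refl) av) sub
  avoiding-max-second x<N r<N av (refl ∷ _ ∷ʳ sub)   = av (refl ∷ sub)
  avoiding-max-second x<N r<N av (refl ∷ refl ∷ sub) = forbidden-max-second x<N (All-resp-⊆ sub r<N)

  avoiding-max-third : All (_< N) (x ∷ y ∷ r) → Open K (x ∷ y ∷ r) →
                       Avoiding K (x ∷ y ∷ r) → Avoiding K (x ∷ y ∷ N ∷ r)
  avoiding-max-third (_ ∷ y<N ∷ r<N) _ av (_ ∷ʳ sub) =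
    avoiding-max-second y<N r<N (avoiding-⊆ (_ ∷ʳ ⊆-refl) av) sub
  avoiding-max-third (x<N ∷ _ ∷ r<N) _ av (refl ∷ _ ∷ʳ sub) =
    avoiding-max-second x<N r<N (avoiding-⊆ (refl ∷ (_ ∷ʳ ⊆-refl)) av) (refl ∷ sub)
  avoiding-max-third _ _ av (refl ∷ refl ∷ _ ∷ʳ sub) = av (refl ∷ refl ∷ sub)
  avoiding-max-third (_ ∷ y<N ∷ _) xy-open av (refl ∷ refl ∷ refl ∷ sub) =
    forbidden-max-third y<N xy-open sub

  max-within-first-three : x < N → y < N → z < N → x ≢ y → y ≢ z →
                           ¬ Avoiding K (x ∷ y ∷ z ∷ p ++ N ∷ q)
  max-within-first-three {x} {N} {y} {z} {p} {q} x<N y<N z<N x≢y y≢z av =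
    contradiction (<-cmp x y) (<-cmp y z)
    where
    N∈ : N ∷ [] ⊆ p ++ N ∷ q
    N∈ = ++⁺ˡ p (refl ∷ minimum q)
    contradiction : Tri (x < y) (x ≡ y) (x > y) → Tri (y < z) (y ≡ z) (y > z) → ⊥
    contradiction (tri< x<y _ _) _              = av (refl ∷ refl ∷ _ ∷ʳ N∈) (pat123 x<y y<N)
    contradiction (tri≈ _ x≡y _) _              = x≢y x≡y
    contradiction (tri> _ _ _)   (tri< y<z _ _) = av (_ ∷ʳ refl ∷ refl ∷ N∈) (pat123 y<z z<N)
    contradiction (tri> _ _ _)   (tri≈ _ y≡z _) = y≢z y≡z
    contradiction (tri> _ _ y<x) (tri> _ _ z<y) = av (refl ∷ refl ∷ refl ∷ N∈) (pat3214 z<y y<x x<N)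

  decreasing-above : Unique s → All (x <_) s → Avoiding K (x ∷ s) → AllPairs _>_ s
  decreasing-above []           []          _  = []
  decreasing-above {e ∷ s} {x} (e∉s ∷ uniq) (x<e ∷ x<s) av =
    All.tabulate below-e ∷ decreasing-above uniq x<s (avoiding-⊆ (refl ∷ (e ∷ʳ ⊆-refl)) av)
    where
    below-e : f ∈ s → e > f
    below-e {f} f∈s with <-cmp e f
    ... | tri< e<f _ _ = ⊥-elim (av (refl ∷ refl ∷ from∈ f∈s) (pat123 x<e e<f))
    ... | tri≈ _ e≡f _ = ⊥-elim (All.lookup e∉s f∈s e≡f)
    ... | tri> _ _ f<e = f<e

  open-when-max-third : Unique (x ∷ y ∷ N ∷ q) → All (_< N) (x ∷ y ∷ q) →
                        Avoiding K (x ∷ y ∷ N ∷ q) → Open K (x ∷ y ∷ q)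
  open-when-max-third {x} {y} {N} {q} uniq@((x≢y ∷ _) ∷ _) (x<N ∷ y<N ∷ q<N) av with <-cmp x y
  ... | tri< x<y _ _ = ⊥-elim (av (refl ∷ refl ∷ refl ∷ minimum q) (pat123 x<y y<N))
  ... | tri≈ _ x≡y _ = ⊥-elim (x≢y x≡y)
  ... | tri> _ _ y<x with K ≤? countAbove x q
  ...   | no  few  = y<x , ≰⇒> few
  ...   | yes many = ⊥-elim (av (refl ∷ refl ∷ refl ∷ s⊆q)
                               (patτ y<x (x<N ∷ All.take⁺ K (All.all-filter (x <?_) q))
                                     (All-resp-⊆ s⊆q q<N ∷ AllPairs.take⁺ K above-decreasing)
                                     (trans (length-take K _) (m≤n⇒m⊓n≡m many))))
    where
    above : List ℕ
    above = filter (x <?_) q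
    s⊆q : take K above ⊆ q
    s⊆q = ⊆-trans (take-⊆ K above) (filter-⊆ (x <?_) q)
    above-decreasing : AllPairs _>_ above
    above-decreasing = decreasing-above (Unique.filter⁺ (x <?_) (Unique.drop⁺ 3 uniq))
      (All.all-filter (x <?_) q) (avoiding-⊆ (refl ∷ (y ∷ʳ N ∷ʳ filter-⊆ (x <?_) q)) av)

-- Permutations of 1, …, n and their largest entry

values-suc : ∀ n → map suc (upTo (suc n)) ≡ map suc (upTo n) ++ [ suc n ]
values-suc n = trans (cong (map suc) (sym (upTo-∷ʳ n))) (map-++ suc (upTo n) [ n ])

perm-below : IsPerm n π → All (_< suc n) π
perm-below {n} perm = All.tabulate λ x∈π → bounded (∈-map⁻ suc (∈-resp-↭ perm x∈π))
  where
  bounded : Σ ℕ (λ i → i ∈ upTo n × x ≡ suc i) → x < suc n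
  bounded (i , i∈ , refl) = s<s (∈-upTo⁻ i∈)

perm-unique : IsPerm n π → Unique π
perm-unique {n} perm = PermutationSetoid.Unique-resp-↭ (setoid ℕ) (↭⇒↭ₛ (↭-sym perm))
  (Unique.map⁺ suc-injective (Unique.upTo⁺ n))

perm-nonempty : IsPerm (suc n) π → π ≢ []
perm-nonempty perm refl with () ← ↭-empty-inv (↭-sym perm)

perm-remove-max : IsPerm (suc n) w →
                  Σ (List ℕ) λ p → Σ (List ℕ) λ q → w ≡ p ++ suc n ∷ q × IsPerm n (p ++ q)
perm-remove-max {n} perm
  with ∈-∃++ (∈-resp-↭ (↭-sym perm) (∈-map⁺ suc (∈-upTo⁺ {suc n} ≤-refl)))
... | p , q , refl = p , q , refl , subst (p ++ q ↭_) (++-identityʳ _)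
  (drop-mid p (map suc (upTo n)) (subst (p ++ suc n ∷ q ↭_) (values-suc n) perm))

perm-insert-max : IsPerm n (p ++ q) → IsPerm (suc n) (p ++ suc n ∷ q)
perm-insert-max {n} {p} {q} perm = ↭-trans (↭-shift (suc n) p q) (↭-trans (↭-prep (suc n) perm)
  (↭-trans (∷↭∷ʳ (suc n) _) (↭-reflexive (sym (values-suc n)))))

InClass : ℕ → ℕ → List ℕ → Set
InClass K n w = IsPerm n w × Avoiding K w

-- Slot K p q: the new maximum may be inserted between p and q.
data Slot (K : ℕ) : List ℕ → List ℕ → Set where
  first  : Slot K [] q
  second : Slot K (x ∷ []) q
  third  : Open K (x ∷ y ∷ q) → Slot K (x ∷ y ∷ []) q

module _ {K : ℕ} where

  avoiding-insert-max : Slot K p q → All (_< N) (p ++ q) →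
                        Avoiding K (p ++ q) → Avoiding K (p ++ N ∷ q)
  avoiding-insert-max first           below         = avoiding-max-first below
  avoiding-insert-max second          (x<N ∷ below) = avoiding-max-second x<N below
  avoiding-insert-max (third xy-open) below         = avoiding-max-third below xy-open

  insert-max : Slot K p q → InClass K n (p ++ q) → InClass K (suc n) (p ++ suc n ∷ q)
  insert-max slot (perm , av) = perm-insert-max perm , avoiding-insert-max slot (perm-below perm) av

  remove-max : InClass K (suc n) w →
               Σ (List ℕ) λ p → Σ (List ℕ) λ q →
                 w ≡ p ++ suc n ∷ q × Slot K p q × InClass K n (p ++ q)
  remove-max {n} (perm , av) with perm-remove-max perm
  ... | p , q , refl , perm′ = p , q , refl , slot p (perm-unique perm) (perm-below perm′) av , perm′ ,
                               avoiding-⊆ (++⁺ ⊆-refl (_ ∷ʳ ⊆-refl)) av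
    where
    slot : ∀ p → Unique (p ++ suc n ∷ q) → All (_< suc n) (p ++ q) → Avoiding K (p ++ suc n ∷ q) →
           Slot K p q
    slot []           _    _     _  = first
    slot (_ ∷ [])     _    _     _  = second
    slot (_ ∷ _ ∷ []) uniq below av = third (open-when-max-third uniq below av)
    slot (_ ∷ _ ∷ _ ∷ _) ((x≢y ∷ _) ∷ (y≢z ∷ _) ∷ _) (x<N ∷ y<N ∷ z<N ∷ _) av =
      ⊥-elim (max-within-first-three x<N y<N z<N x≢y y≢z av)

insertAt : ℕ → ℕ → List ℕ → List ℕ
insertAt zero    N π       = N ∷ π
insertAt (suc i) N []      = N ∷ []
insertAt (suc i) N (x ∷ π) = x ∷ insertAt i N π

length-insertAt : ∀ i → length (insertAt i N π) ≡ suc (length π)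
length-insertAt                 zero    = refl
length-insertAt {π = []}        (suc i) = refl
length-insertAt {π = _ ∷ π}     (suc i) = cong suc (length-insertAt {π = π} i)

insertAt-injective : ∀ i → insertAt i N π ≡ insertAt i N ρ → π ≡ ρ
insertAt-injective zero eq = ∷-injectiveʳ eq
insertAt-injective {π = []}    {ρ = []}    (suc i) _  = refl
insertAt-injective {π = []}    {ρ = _ ∷ ρ} (suc i) eq
  with () ← trans (cong length eq) (cong suc (length-insertAt {π = ρ} i))
insertAt-injective {π = _ ∷ π} {ρ = []}    (suc i) eq
  with () ← trans (sym (cong length eq)) (cong suc (length-insertAt {π = π} i))
insertAt-injective {π = _ ∷ _} {ρ = _ ∷ _} (suc i) eq =
  cong₂ _∷_ (∷-injectiveˡ eq) (insertAt-injective i (∷-injectiveʳ eq))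

Fits : ℕ → ℕ → List ℕ → Set
Fits N i π = All (_< N) π × i ≤ length π

insertAt-position : Fits N i π → Fits N j ρ → insertAt i N π ≡ insertAt j N ρ → i ≡ j
insertAt-position {i = zero}  {j = zero}                  _             _             _  = refl
insertAt-position {i = zero}  {j = suc _} {ρ = _ ∷ _}     _             (y<N ∷ _ , _) eq =
  ⊥-elim (<-irrefl (sym (∷-injectiveˡ eq)) y<N)
insertAt-position {i = suc _} {π = _ ∷ _} {j = zero}      (x<N ∷ _ , _) _             eq =
  ⊥-elim (<-irrefl (∷-injectiveˡ eq) x<N)
insertAt-position {i = suc _} {π = _ ∷ _} {j = suc _} {ρ = _ ∷ _}
                  (_ ∷ π<N , s≤s i≤) (_ ∷ ρ<N , s≤s j≤) eq =
  cong suc (insertAt-position (π<N , i≤) (ρ<N , j≤) (∷-injectiveʳ eq))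

insertAt-disjoint : i ≢ j → All (Fits N i) xs → All (Fits N j) ys →
                    Disjoint (map (insertAt i N) xs) (map (insertAt j N) ys)
insertAt-disjoint i≢j fits-xs fits-ys (w∈ , w∈′) with ∈-map⁻ _ w∈ | ∈-map⁻ _ w∈′
... | π , π∈ , refl | ρ , ρ∈ , eq =
  i≢j (insertAt-position (All.lookup fits-xs π∈) (All.lookup fits-ys ρ∈) eq)

disjoint-++ : Disjoint xs ys → Disjoint xs zs → Disjoint xs (ys ++ zs)
disjoint-++ {ys = ys} xs#ys xs#zs (w∈xs , w∈ys++zs) with ∈-++⁻ ys w∈ys++zs
... | inj₁ w∈ys = xs#ys (w∈xs , w∈ys)
... | inj₂ w∈zs = xs#zs (w∈xs , w∈zs)

length-map-++ : ∀ {A B C : Set} (f : A → C) (g : B → C) as bs →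
                length (map f as ++ map g bs) ≡ length as + length bs
length-map-++ f g as bs = trans (length-++ (map f as)) (cong₂ _+_ (length-map f as) (length-map g bs))

-- Power series

-- The coefficient sequence of x^j · f(x).
shift : ℕ → (ℕ → ℕ) → ℕ → ℕ
shift zero    f n       = f n
shift (suc j) f zero    = 0
shift (suc j) f (suc n) = shift j f n

shift-vanishes : ∀ {f} j → f 0 ≡ 0 → n ≤ j → shift j f n ≡ 0
shift-vanishes         zero    f₀ z≤n       = f₀
shift-vanishes {zero}  (suc j) f₀ _         = refl
shift-vanishes {suc n} (suc j) f₀ (s≤s n≤j) = shift-vanishes j f₀ n≤j

δ-suc : ∀ n m → δ (suc n) (suc m) ≡ δ n m
δ-suc n m with n ≟ m | suc n ≟ suc m
... | yes _    | yes _     = refl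
... | no  _    | no  _     = refl
... | yes refl | no  n≢n   = ⊥-elim (n≢n refl)
... | no  n≢m  | yes sn≡sm = ⊥-elim (n≢m (suc-injective sn≡sm))

private
  *-zero-+ : ∀ a b → b ≡ a ℤ.* + 0 ℤ.+ b
  *-zero-+ = ℤ-Solver.solve-∀

  *-distrib-+-+ : ∀ a b c x y →
                  a ℤ.* (b ℤ.+ c) ℤ.+ (x ℤ.+ y) ≡ (a ℤ.* b ℤ.+ x) ℤ.+ (a ℤ.* c ℤ.+ y)
  *-distrib-+-+ = ℤ-Solver.solve-∀

⊛-suc : ∀ (f g : Series) n → (f ⊛ g) (suc n) ≡ f 0 ℤ.* g (suc n) ℤ.+ ((f ∘ suc) ⊛ g) n
⊛-suc f g n = cong (ℤ._+_ (f 0 ℤ.* g (suc n))) (cong (foldr ℤ._+_ (+ 0))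
  (trans (map-applyUpTo suc (λ i → f i ℤ.* g (suc n ∸ i)) (suc n))
         (sym (map-applyUpTo id (λ i → f (suc i) ℤ.* g (n ∸ i)) (suc n)))))

⊛-distribʳ-+ : ∀ (f g h : Series) n → (f ⊛ (λ m → g m ℤ.+ h m)) n ≡ (f ⊛ g) n ℤ.+ (f ⊛ h) n
⊛-distribʳ-+ f g h zero    = *-distrib-+-+ (f 0) (g 0) (h 0) (+ 0) (+ 0)
⊛-distribʳ-+ f g h (suc n) = begin
  (f ⊛ (λ m → g m ℤ.+ h m)) (suc n)
    ≡⟨ ⊛-suc f (λ m → g m ℤ.+ h m) n ⟩
  f 0 ℤ.* (g (suc n) ℤ.+ h (suc n)) ℤ.+ ((f ∘ suc) ⊛ (λ m → g m ℤ.+ h m)) n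
    ≡⟨ cong (ℤ._+_ (f 0 ℤ.* (g (suc n) ℤ.+ h (suc n)))) (⊛-distribʳ-+ (f ∘ suc) g h n) ⟩
  f 0 ℤ.* (g (suc n) ℤ.+ h (suc n)) ℤ.+ (((f ∘ suc) ⊛ g) n ℤ.+ ((f ∘ suc) ⊛ h) n)
    ≡⟨ *-distrib-+-+ (f 0) (g (suc n)) (h (suc n)) (((f ∘ suc) ⊛ g) n) (((f ∘ suc) ⊛ h) n) ⟩
  (f 0 ℤ.* g (suc n) ℤ.+ ((f ∘ suc) ⊛ g) n) ℤ.+ (f 0 ℤ.* h (suc n) ℤ.+ ((f ∘ suc) ⊛ h) n)
    ≡⟨ cong₂ ℤ._+_ (⊛-suc f g n) (⊛-suc f h n) ⟨
  (f ⊛ g) (suc n) ℤ.+ (f ⊛ h) (suc n)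
    ∎
  where open ≡-Reasoning

shift-split : ∀ j (f : ℕ → ℕ) n → + shift j f n ≡ + f 0 ℤ.* δ n j ℤ.+ + shift (suc j) (f ∘ suc) n
shift-split zero    f zero    = *-identity-+ (+ f 0)
  where
  *-identity-+ : ∀ a → a ≡ a ℤ.* + 1 ℤ.+ + 0
  *-identity-+ = ℤ-Solver.solve-∀
shift-split zero    f (suc n) = *-zero-+ (+ f 0) (+ f (suc n))
shift-split (suc j) f zero    = *-zero-+ (+ f 0) (+ 0)
shift-split (suc j) f (suc n) =
  trans (shift-split j f n) (cong (λ d → + f 0 ℤ.* d ℤ.+ + shift (suc j) (f ∘ suc) n) (sym (δ-suc n j)))

⊛-δ : ∀ (f : ℕ → ℕ) j n → ((λ m → + f m) ⊛ (λ m → δ m j)) n ≡ + shift j f n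
⊛-δ f j zero    = sym (shift-split j f 0)
⊛-δ f j (suc n) = begin
  ((λ m → + f m) ⊛ (λ m → δ m j)) (suc n)
    ≡⟨ ⊛-suc (λ m → + f m) (λ m → δ m j) n ⟩
  + f 0 ℤ.* δ (suc n) j ℤ.+ ((λ m → + f (suc m)) ⊛ (λ m → δ m j)) n
    ≡⟨ cong (ℤ._+_ (+ f 0 ℤ.* δ (suc n) j)) (⊛-δ (f ∘ suc) j n) ⟩
  + f 0 ℤ.* δ (suc n) j ℤ.+ + shift j (f ∘ suc) n
    ≡⟨ shift-split j f (suc n) ⟨
  + shift j f (suc n)
    ∎
  where open ≡-Reasoning

⊛-denom∞ : ∀ (f : Series) n → (f ⊛ denom∞) (2 + n) ≡ f (2 + n) ℤ.- + 3 ℤ.* f (1 + n) ℤ.+ f n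
⊛-denom∞ f zero    = expand (f 0) (f 1) (f 2)
  where
  expand : ∀ a b c →
           a ℤ.* + 1 ℤ.+ (b ℤ.* -[1+ 2 ] ℤ.+ (c ℤ.* + 1 ℤ.+ + 0)) ≡ c ℤ.- + 3 ℤ.* b ℤ.+ a
  expand = ℤ-Solver.solve-∀
⊛-denom∞ f (suc n) = trans (⊛-suc f denom∞ (2 + n))
  (trans (cong (ℤ._+_ (f 0 ℤ.* + 0)) (⊛-denom∞ (f ∘ suc) n)) (sym (*-zero-+ (f 0) _)))

recurrence-in-ℤ : ∀ a b c → a + c ≡ 3 * b → + a ℤ.- + 3 ℤ.* + b ℤ.+ + c ≡ + 0
recurrence-in-ℤ a b c a+c≡3b = begin
  + a ℤ.- + 3 ℤ.* + b ℤ.+ + c    ≡⟨ regroup (+ a) (+ b) (+ c) ⟩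
  (+ a ℤ.+ + c) ℤ.- + 3 ℤ.* + b  ≡⟨ cong (ℤ._- + 3 ℤ.* + b) a+c≡3b-in-ℤ ⟩
  + 3 ℤ.* + b ℤ.- + 3 ℤ.* + b    ≡⟨ cancel (+ 3 ℤ.* + b) ⟩
  + 0                            ∎
  where
  open ≡-Reasoning
  a+c≡3b-in-ℤ : + a ℤ.+ + c ≡ + 3 ℤ.* + b
  a+c≡3b-in-ℤ = trans (sym (pos-+ a c)) (trans (cong +_ a+c≡3b) (pos-* 3 b))
  regroup : ∀ x y z → x ℤ.- + 3 ℤ.* y ℤ.+ z ≡ (x ℤ.+ z) ℤ.- + 3 ℤ.* y
  regroup = ℤ-Solver.solve-∀
  cancel : ∀ x → x ℤ.- x ≡ + 0
  cancel = ℤ-Solver.solve-∀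

-- Even-index Fibonacci numbers

fib-recurrence₂ : ∀ n → fib (4 + n) + fib n ≡ 3 * fib (2 + n)
fib-recurrence₂ n = expand (fib (suc n)) (fib n)
  where
  expand : ∀ x y → x + y + x + (x + y) + y ≡ 3 * (x + y)
  expand = solve-∀

evenFib-recurrence : ∀ n → evenFib (2 + n) + evenFib n ≡ 3 * evenFib (1 + n)
evenFib-recurrence zero    = refl
evenFib-recurrence (suc n) rewrite +-suc n (suc n) | +-suc n n = fib-recurrence₂ (suc (n + n))

evenFib-gf : ∀ n → ((λ m → + evenFib m) ⊛ denom∞) n ≡ numer∞ n
evenFib-gf 0             = refl
evenFib-gf 1             = refl
evenFib-gf (suc (suc n)) = trans (⊛-denom∞ (λ m → + evenFib m) n)
  (recurrence-in-ℤ (evenFib (2 + n)) (evenFib (1 + n)) (evenFib n) (evenFib-recurrence n))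

recurrence-agree : ∀ {a b : ℕ → ℕ} B → a 0 ≡ b 0 → a 1 ≡ b 1 →
                   (∀ m → m ≤ B → a (2 + m) + a m ≡ 3 * a (1 + m)) →
                   (∀ m → m ≤ B → b (2 + m) + b m ≡ 3 * b (1 + m)) →
                   ∀ n → n ≤ 2 + B → a n ≡ b n
recurrence-agree {a} {b} B a₀ a₁ rec-a rec-b zero    _           = a₀
recurrence-agree {a} {b} B a₀ a₁ rec-a rec-b (suc n) (s≤s n≤1+B) = proj₂ (consecutive n n≤1+B)
  where
  consecutive : ∀ n → n ≤ 1 + B → a n ≡ b n × a (1 + n) ≡ b (1 + n)
  consecutive zero    _         = a₀ , a₁
  consecutive (suc n) (s≤s n≤B) with consecutive n (m≤n⇒m≤1+n n≤B)
  ... | aₙ , aₙ₊₁ = aₙ₊₁ , +-cancelʳ-≡ (a n) _ _ (begin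
    a (2 + n) + a n  ≡⟨ rec-a n n≤B ⟩
    3 * a (1 + n)    ≡⟨ cong (3 *_) aₙ₊₁ ⟩
    3 * b (1 + n)    ≡⟨ rec-b n n≤B ⟨
    b (2 + n) + b n  ≡⟨ cong (_+_ (b (2 + n))) aₙ ⟨
    b (2 + n) + a n  ∎)
    where open ≡-Reasoning

card-unique : ∀ {P : List ℕ → Set} {c c′} → HasCard P c → HasCard P c′ → c ≡ c′
card-unique (L , L-unique , L⇔P , refl) (L′ , L′-unique , L′⇔P , refl) =
  ↭-length (∼bag⇒↭ (unique∧set⇒bag L-unique L′-unique λ {w} →
    mk⇔ (from (L′⇔P w) ∘ to (L⇔P w)) (from (L⇔P w) ∘ to (L′⇔P w))))

-- The generating tree

module Enumeration (K : ℕ) where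

  -- avoiders⁺ n lists the nonempty members of the class, openAvoiders n b those satisfying Open b.
  mutual
    avoiders : ℕ → List (List ℕ)
    avoiders zero    = [] ∷ []
    avoiders (suc n) = map (insertAt 0 (suc n)) (avoiders n)
                    ++ map (insertAt 1 (suc n)) (avoiders⁺ n)
                    ++ map (insertAt 2 (suc n)) (openAvoiders n K)

    avoiders⁺ : ℕ → List (List ℕ)
    avoiders⁺ zero    = []
    avoiders⁺ (suc n) = avoiders (suc n)

    openAvoiders : ℕ → ℕ → List (List ℕ)
    openAvoiders zero    _       = []
    openAvoiders (suc n) zero    = []
    openAvoiders (suc n) (suc b) = map (insertAt 0 (suc n)) (avoiders⁺ n)
                                ++ map (insertAt 2 (suc n)) (openAvoiders n b)

  InClass⁺ : ℕ → List ℕ → Set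
  InClass⁺ n π = InClass K n π × π ≢ []

  OpenInClass : ℕ → ℕ → List ℕ → Set
  OpenInClass n b π = InClass K n π × Open b π

  insert-first : InClass K n π → InClass K (suc n) (insertAt 0 (suc n) π)
  insert-first = insert-max first

  insert-second : InClass⁺ n π → InClass K (suc n) (insertAt 1 (suc n) π)
  insert-second {π = []}    (_ , π≢[]) = ⊥-elim (π≢[] refl)
  insert-second {π = _ ∷ _} (cls , _)  = insert-max second cls

  insert-third : ∀ {b} → b ≤ K → OpenInClass n b π → InClass K (suc n) (insertAt 2 (suc n) π)
  insert-third {π = x ∷ y ∷ r} b≤K (cls , xy-open) =
    insert-max (third (Open-mono {x ∷ y ∷ r} b≤K xy-open)) cls

  insert-first-open : ∀ {b} → InClass⁺ n π → OpenInClass (suc n) (suc b) (insertAt 0 (suc n) π)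
  insert-first-open {π = []}    (_ , π≢[]) = ⊥-elim (π≢[] refl)
  insert-first-open {π = _ ∷ r} (cls@(perm , _) , _) with perm-below perm
  ... | y<N ∷ r<N = insert-first cls , y<N , subst (_< _) (sym (countAbove-max r<N)) z<s

  insert-third-open : ∀ {b} → suc b ≤ K → OpenInClass n b π →
                      OpenInClass (suc n) (suc b) (insertAt 2 (suc n) π)
  insert-third-open {π = _ ∷ _ ∷ _} b<K xy-open@((perm , _) , o) =
    insert-third (<⇒≤ b<K) xy-open , from (Open-third⇔ (All.head (perm-below perm))) o

  mutual
    avoiders-sound : ∀ n → All (InClass K n) (avoiders n)
    avoiders-sound zero    = (↭-refl , λ { [] () }) ∷ []
    avoiders-sound (suc n) =
      All.++⁺ (All.map⁺ (All.map insert-first (avoiders-sound n)))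
      (All.++⁺ (All.map⁺ (All.map insert-second (avoiders⁺-sound n)))
               (All.map⁺ (All.map (insert-third ≤-refl) (openAvoiders-sound n K ≤-refl))))

    avoiders⁺-sound : ∀ n → All (InClass⁺ n) (avoiders⁺ n)
    avoiders⁺-sound zero    = []
    avoiders⁺-sound (suc n) = All.map (λ cls → cls , perm-nonempty (proj₁ cls)) (avoiders-sound (suc n))

    openAvoiders-sound : ∀ n b → b ≤ K → All (OpenInClass n b) (openAvoiders n b)
    openAvoiders-sound zero    _       _   = []
    openAvoiders-sound (suc n) zero    _   = []
    openAvoiders-sound (suc n) (suc b) b<K =
      All.++⁺ (All.map⁺ (All.map insert-first-open (avoiders⁺-sound n)))
              (All.map⁺ (All.map (insert-third-open b<K) (openAvoiders-sound n b (<⇒≤ b<K))))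

  mutual
    avoiders-complete : InClass K n w → w ∈ avoiders n
    avoiders-complete {zero}  (perm , _) with refl ← ↭-empty-inv perm = here refl
    avoiders-complete {suc n} cls with remove-max cls
    ... | _ , _ , refl , first   , cls′ = ∈-++⁺ˡ (∈-map⁺ _ (avoiders-complete cls′))
    ... | _ , _ , refl , second  , cls′ = ∈-++⁺ʳ (map (insertAt 0 (suc n)) (avoiders n))
      (∈-++⁺ˡ (∈-map⁺ (insertAt 1 (suc n)) (avoiders⁺-complete (cls′ , λ ()))))
    ... | _ , _ , refl , third o , cls′ = ∈-++⁺ʳ (map (insertAt 0 (suc n)) (avoiders n))
      (∈-++⁺ʳ (map (insertAt 1 (suc n)) (avoiders⁺ n))
        (∈-map⁺ (insertAt 2 (suc n)) (openAvoiders-complete ≤-refl (cls′ , o))))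

    avoiders⁺-complete : InClass⁺ n w → w ∈ avoiders⁺ n
    avoiders⁺-complete {zero}  ((perm , _) , w≢[]) = ⊥-elim (w≢[] (↭-empty-inv perm))
    avoiders⁺-complete {suc n} (cls , _)           = avoiders-complete cls

    openAvoiders-complete : ∀ {b} → b ≤ K → OpenInClass n b w → w ∈ openAvoiders n b
    openAvoiders-complete {zero}             _   ((perm , _) , o) with refl ← ↭-empty-inv perm = ⊥-elim o
    openAvoiders-complete {suc n} {b = zero}  _   (_ , o)         = ⊥-elim (Open-zero o)
    openAvoiders-complete {suc n} {b = suc b} b<K (cls , o) with remove-max cls
    ... | _ , _ , refl , first   , cls′ =
      ∈-++⁺ˡ (∈-map⁺ _ (avoiders⁺-complete (cls′ , λ { refl → o })))
    ... | _ , _ , refl , second  , (perm′ , _) = ⊥-elim (<-asym (proj₁ o) (All.head (perm-below perm′)))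
    ... | _ , _ , refl , third _ , cls′@(perm′ , _) =
      ∈-++⁺ʳ (map (insertAt 0 (suc n)) (avoiders⁺ n)) (∈-map⁺ (insertAt 2 (suc n))
        (openAvoiders-complete (<⇒≤ b<K) (cls′ , to (Open-third⇔ (All.head (perm-below perm′))) o)))

  fits-first : InClass K n π → Fits (suc n) 0 π
  fits-first (perm , _) = perm-below perm , z≤n

  fits-second : InClass⁺ n π → Fits (suc n) 1 π
  fits-second {π = []}    (_ , π≢[])       = ⊥-elim (π≢[] refl)
  fits-second {π = _ ∷ _} ((perm , _) , _) = perm-below perm , s≤s z≤n

  fits-third : ∀ {b} → OpenInClass n b π → Fits (suc n) 2 π
  fits-third {π = _ ∷ _ ∷ _} ((perm , _) , _) = perm-below perm , s≤s (s≤s z≤n)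

  mutual
    avoiders-unique : ∀ n → Unique (avoiders n)
    avoiders-unique zero    = [] ∷ []
    avoiders-unique (suc n) =
      Unique.++⁺ (Unique.map⁺ (insertAt-injective 0) (avoiders-unique n))
        (Unique.++⁺ (Unique.map⁺ (insertAt-injective 1) (avoiders⁺-unique n))
                    (Unique.map⁺ (insertAt-injective 2) (openAvoiders-unique n K ≤-refl))
                    (insertAt-disjoint (λ ()) fits₁ fits₂))
        (disjoint-++ (insertAt-disjoint (λ ()) fits₀ fits₁) (insertAt-disjoint (λ ()) fits₀ fits₂))
      where
      fits₀ : All (Fits (suc n) 0) (avoiders n)
      fits₀ = All.map fits-first (avoiders-sound n)
      fits₁ : All (Fits (suc n) 1) (avoiders⁺ n)
      fits₁ = All.map fits-second (avoiders⁺-sound n)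
      fits₂ : All (Fits (suc n) 2) (openAvoiders n K)
      fits₂ = All.map fits-third (openAvoiders-sound n K ≤-refl)

    avoiders⁺-unique : ∀ n → Unique (avoiders⁺ n)
    avoiders⁺-unique zero    = []
    avoiders⁺-unique (suc n) = avoiders-unique (suc n)

    openAvoiders-unique : ∀ n b → b ≤ K → Unique (openAvoiders n b)
    openAvoiders-unique zero    _       _   = []
    openAvoiders-unique (suc n) zero    _   = []
    openAvoiders-unique (suc n) (suc b) b<K =
      Unique.++⁺ (Unique.map⁺ (insertAt-injective 0) (avoiders⁺-unique n))
                 (Unique.map⁺ (insertAt-injective 2) (openAvoiders-unique n b (<⇒≤ b<K)))
                 (insertAt-disjoint (λ ()) (All.map (fits-first ∘ proj₁) (avoiders⁺-sound n))
                                           (All.map fits-third (openAvoiders-sound n b (<⇒≤ b<K))))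

  ∈-avoiders⇔ : ∀ n w → (w ∈ avoiders n) ⇔ avSet (2 + K) n w
  ∈-avoiders⇔ n w = mk⇔
    (λ w∈ → let (perm , av) = All.lookup (avoiders-sound n) w∈ in perm , from avoids-patterns⇔ av)
    (λ (perm , avs) → avoiders-complete (perm , to avoids-patterns⇔ avs))

  size size⁺ : ℕ → ℕ
  size  n = length (avoiders n)
  size⁺ n = length (avoiders⁺ n)

  openSize : ℕ → ℕ → ℕ
  openSize n b = length (openAvoiders n b)

  avoiders-card : ∀ n → HasCard (avSet (2 + K) n) (size n)
  avoiders-card n = avoiders n , avoiders-unique n , ∈-avoiders⇔ n , refl

  size-suc : ∀ n → size (suc n) ≡ size n + (size⁺ n + openSize n K)
  size-suc n = trans (length-++ (map (insertAt 0 (suc n)) (avoiders n)))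
    (cong₂ _+_ (length-map _ (avoiders n)) (length-map-++ _ _ (avoiders⁺ n) (openAvoiders n K)))

  openSize-suc : ∀ n b → openSize (suc n) (suc b) ≡ size⁺ n + openSize n b
  openSize-suc n b = length-map-++ _ _ (avoiders⁺ n) (openAvoiders n b)

  openSize-slide : ∀ n b → size⁺ n + openSize n b ≡ openSize (suc n) b + shift b size⁺ n
  openSize-slide zero    zero    = refl
  openSize-slide (suc n) zero    = +-identityʳ (size⁺ (suc n))
  openSize-slide zero    (suc b) = refl
  openSize-slide (suc n) (suc b) = begin
    e₁ + openSize (suc n) (suc b)               ≡⟨ cong (_+_ e₁) (openSize-suc n b) ⟩
    e₁ + (size⁺ n + openSize n b)               ≡⟨ cong (_+_ e₁) (openSize-slide n b) ⟩
    e₁ + (openSize (suc n) b + shift b size⁺ n) ≡⟨ +-assoc e₁ _ _ ⟨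
    e₁ + openSize (suc n) b + shift b size⁺ n   ≡⟨ cong (_+ shift b size⁺ n) (openSize-suc (suc n) b) ⟨
    openSize (suc (suc n)) (suc b) + shift b size⁺ n ∎
    where
    open ≡-Reasoning
    e₁ : ℕ
    e₁ = size⁺ (suc n)

  size-recurrence : ∀ n → size (2 + n) + size n + shift K size⁺ n ≡ 3 * size (1 + n)
  size-recurrence n = begin
    a₂ + a₀ + shift K size⁺ n
      ≡⟨ cong (λ t → t + a₀ + shift K size⁺ n) (size-suc (1 + n)) ⟩
    a₁ + (a₁ + openSize (1 + n) K) + a₀ + shift K size⁺ n
      ≡⟨ regroup a₁ (openSize (1 + n) K) a₀ (shift K size⁺ n) ⟩
    a₁ + a₁ + (a₀ + (openSize (1 + n) K + shift K size⁺ n))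
      ≡⟨ cong (λ t → a₁ + a₁ + (a₀ + t)) (openSize-slide n K) ⟨
    a₁ + a₁ + (a₀ + (size⁺ n + openSize n K))
      ≡⟨ cong (_+_ (a₁ + a₁)) (size-suc n) ⟨
    a₁ + a₁ + a₁
      ≡⟨ triple a₁ ⟩
    3 * a₁
      ∎
    where
    open ≡-Reasoning
    a₀ a₁ a₂ : ℕ
    a₀ = size n
    a₁ = size (1 + n)
    a₂ = size (2 + n)
    regroup : ∀ a b c d → a + (a + b) + c + d ≡ a + a + (c + (b + d))
    regroup = solve-∀
    triple : ∀ a → a + a + a ≡ 3 * a
    triple = solve-∀

  shift-size : ∀ j n → + shift j size n ≡ + shift j size⁺ n ℤ.+ δ n j
  shift-size zero    zero    = refl
  shift-size zero    (suc n) = sym (ℤ.+-identityʳ (+ size (suc n)))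
  shift-size (suc j) zero    = refl
  shift-size (suc j) (suc n) = trans (shift-size j n) (cong (ℤ._+_ (+ shift j size⁺ n)) (sym (δ-suc n j)))

  size-gf : ∀ n → ((λ m → + size m) ⊛ denom (2 + K)) n ≡ numer (2 + K) n
  size-gf 0             = refl
  size-gf 1             = refl
  size-gf (suc (suc n)) = begin
    (A ⊛ denom (2 + K)) (2 + n)
      ≡⟨ ⊛-distribʳ-+ A denom∞ (λ m → δ m (2 + K)) (2 + n) ⟩
    (A ⊛ denom∞) (2 + n) ℤ.+ (A ⊛ (λ m → δ m (2 + K))) (2 + n)
      ≡⟨ cong₂ ℤ._+_ (⊛-denom∞ A n) (⊛-δ size (2 + K) (2 + n)) ⟩
    A₂ ℤ.- + 3 ℤ.* A₁ ℤ.+ A₀ ℤ.+ + shift K size n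
      ≡⟨ cong (ℤ._+_ (A₂ ℤ.- + 3 ℤ.* A₁ ℤ.+ A₀)) (shift-size K n) ⟩
    A₂ ℤ.- + 3 ℤ.* A₁ ℤ.+ A₀ ℤ.+ (+ shift K size⁺ n ℤ.+ δ n K)
      ≡⟨ regroup A₂ A₁ A₀ (+ shift K size⁺ n) (δ n K) ⟩
    A₂ ℤ.- + 3 ℤ.* A₁ ℤ.+ (A₀ ℤ.+ + shift K size⁺ n) ℤ.+ δ n K
      ≡⟨ cong (λ t → A₂ ℤ.- + 3 ℤ.* A₁ ℤ.+ t ℤ.+ δ n K) (pos-+ (size n) (shift K size⁺ n)) ⟨
    A₂ ℤ.- + 3 ℤ.* A₁ ℤ.+ + (size n + shift K size⁺ n) ℤ.+ δ n K
      ≡⟨ cong (ℤ._+ δ n K) (recurrence-in-ℤ (size (2 + n)) (size (1 + n)) (size n + shift K size⁺ n)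
                              (trans (sym (+-assoc (size (2 + n)) _ _)) (size-recurrence n))) ⟩
    + 0 ℤ.+ δ n K
      ≡⟨ cong (ℤ._+_ (+ 0)) (trans (δ-suc (1 + n) (1 + K)) (δ-suc n K)) ⟨
    numer (2 + K) (2 + n)
      ∎
    where
    open ≡-Reasoning
    A : Series
    A m = + size m
    A₀ A₁ A₂ : ℤ.ℤ
    A₀ = A n
    A₁ = A (1 + n)
    A₂ = A (2 + n)
    regroup : ∀ a b c s d →
              a ℤ.- + 3 ℤ.* b ℤ.+ c ℤ.+ (s ℤ.+ d) ≡ a ℤ.- + 3 ℤ.* b ℤ.+ (c ℤ.+ s) ℤ.+ d
    regroup = ℤ-Solver.solve-∀

  size-recurrence-below : ∀ n → n ≤ K → size (2 + n) + size n ≡ 3 * size (1 + n)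
  size-recurrence-below n n≤K = begin
    size (2 + n) + size n                    ≡⟨ +-identityʳ _ ⟨
    size (2 + n) + size n + 0                ≡⟨ cong (_+_ (size (2 + n) + size n)) shift≡0 ⟨
    size (2 + n) + size n + shift K size⁺ n  ≡⟨ size-recurrence n ⟩
    3 * size (1 + n)                         ∎
    where
    open ≡-Reasoning
    shift≡0 : shift K size⁺ n ≡ 0
    shift≡0 = shift-vanishes K refl n≤K

  size≡evenFib : ∀ n → n ≤ 2 + K → size n ≡ evenFib n
  size≡evenFib = recurrence-agree K refl refl size-recurrence-below (λ m _ → evenFib-recurrence m)

avoiders-generatingFunction : (k : ℕ) → 2 ≤ k →
  Σ (ℕ → ℕ) λ a → ((n : ℕ) → HasCard (avSet k n) (a n)) ×
                  ((n : ℕ) → ((λ m → + (a m)) ⊛ denom k) n ≡ numer k n)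
avoiders-generatingFunction (suc (suc K)) (s≤s (s≤s z≤n)) =
  Enumeration.size K , Enumeration.avoiders-card K , Enumeration.size-gf K

avoiders≡evenFib : ∀ k n c → n ≤ k → 2 ≤ k → HasCard (avSet k n) c → c ≡ evenFib n
avoiders≡evenFib (suc (suc K)) n c n≤k (s≤s (s≤s z≤n)) card =
  trans (card-unique card (Enumeration.avoiders-card K n)) (Enumeration.size≡evenFib K n n≤k)

mainTheorem5 :
    ((k : ℕ) → 3 ≤ k →
      Σ (ℕ → ℕ) λ a →
        ((n : ℕ) → HasCard (avSet k n) (a n)) ×
        ((n : ℕ) → ((λ m → + (a m)) ⊛ denom k) n ≡ numer k n))
    ×
    (((n : ℕ) → ((λ m → + (evenFib m)) ⊛ denom∞) n ≡ numer∞ n) ×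
     ((n : ℕ) → Σ ℕ λ K → (k : ℕ) → K ≤ k → 3 ≤ k → (c : ℕ) →
        HasCard (avSet k n) c → c ≡ evenFib n))
mainTheorem5 =
  (λ k 3≤k → avoiders-generatingFunction k (<⇒≤ 3≤k)) ,
  evenFib-gf ,
  λ n → n , λ k n≤k 3≤k c card → avoiders≡evenFib k n c n≤k (<⇒≤ 3≤k) card
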